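{- There is no formula $\textsc{MinimumSR}(x,y)$ of $\textsc{FOIL}$ such that, for every decision tree $\mathcal{T}$, every instance $\mathbf{e}$ and every partial instance $\mathbf{e}'$ of dimension $\dim(\mathcal{T})$, we have $\mathcal{T} \models \textsc{MinimumSR}(\mathbf{e},\mathbf{e}')$ if and only if $\mathbf{e}'$ is a minimum sufficient reason for $\mathbf{e}$ over $\mathcal{T}$.
   Context: A model of dimension $n$ is a Boolean function $\mathcal{M}:\{0,1\}^n\to\{0,1\}$. A partial instance of dimension $n$ is a tuple $\mathbf{e}\in\{0,1,\bot\}^n$ ($\bot$ = undefined); an instance is a partial instance in $\{0,1\}^n$. Write $\mathbf{e}_\bot=\{i\mid \mathbf{e}[i]=\bot\}$. $\mathbf{e}_1$ is subsumed by $\mathbf{e}_2$ if $\mathbf{e}_1[i]=\mathbf{e}_2[i]$ for every $i$ with $\mathbf{e}_1[i]\neq\bot$; the instances subsuming $\mathbf{e}$ are its completions. A decision tree of dimension $n$ is a rooted directed binary tree whose leaves are labeled $\mathsf{true}$ or $\mathsf{false}$, whose internal nodes are labeled by features in $\{1,\dots,n\}$ with two outgoing edges labeled $0$ and $1$, and in which no feature repeats along a root-to-leaf path; it classifies an instance $\mathbf{e}$ by following at each node labeled $j$ the edge labeled $\mathbf{e}[j]$, giving $\mathcal{T}(\mathbf{e})=1$ iff the reached leaf is labeled $\mathsf{true}$. $\textsc{FOIL}$ is first-order logic over the vocabulary $\{\textsc{Pos},\subseteq\}$; a model $\mathcal{M}$ of dimension $n$ is interpreted as the structure with domain $\{0,1,\bot\}^n$,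 where $\textsc{Pos}$ holds exactly for instances $\mathbf{e}\in\{0,1\}^n$ with $\mathcal{M}(\mathbf{e})=1$ and $\subseteq$ is the subsumption relation; $\mathcal{M}\models\varphi(\mathbf{e}_1,\dots,\mathbf{e}_k)$ means this structure satisfies $\varphi$ under the assignment. A sufficient reason for an instance $\mathbf{e}$ over $\mathcal{T}$ is a partial instance $\mathbf{e}'$ subsumed by $\mathbf{e}$ such that every completion $\mathbf{e}''$ of $\mathbf{e}'$ has $\mathcal{T}(\mathbf{e}'')=\mathcal{T}(\mathbf{e})$. It is minimum if there is no sufficient reason $\mathbf{e}''$ for $\mathbf{e}$ over $\mathcal{T}$ with $|\mathbf{e}''_\bot|>|\mathbf{e}'_\bot|$. -}

module Defs where

open import Data.Nat using (ℕ; zero; suc; _>_)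
open import Data.Bool using (Bool; true; false)
open import Data.Fin using (Fin; zero; suc)
open import Data.Vec using (Vec; []; _∷_; lookup; map)
open import Data.List using (List; []; _∷_)
open import Data.List.Membership.Propositional using (_∉_)
open import Data.Product using (Σ; _×_)
open import Data.Sum using (_⊎_)
open import Data.Unit using (⊤)
open import Data.Empty using (⊥)
open import Relation.Binary.PropositionalEquality using (_≡_; _≢_)

data Val : Set where
  v0 v1 undef : Val

PInst : ℕ → Set
PInst n = Vec Val n

Inst : ℕ → Set
Inst n = Vec Bool n

toVal : Bool → Val
toVal false = v0
toVal true  = v1

embed : ∀ {n} → Inst n → PInst n
embed = map toVal

_⊑_ : ∀ {n} → PInst n → PInst n → Set
_⊑_ {n} e₁ e₂ = (i : Fin n) → lookup e₁ i ≢ undef → lookup e₁ i ≡ lookup e₂ i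

countUndef : ∀ {n} → PInst n → ℕ
countUndef [] = 0
countUndef (undef ∷ e) = suc (countUndef e)
countUndef (v0 ∷ e) = countUndef e
countUndef (v1 ∷ e) = countUndef e

Model : ℕ → Set
Model n = Inst n → Bool

-- Decision trees of dimension n (leaves labelled true/false,
-- internal nodes labelled by a feature, first subtree = edge 0,
-- second subtree = edge 1).
data DTree (n : ℕ) : Set where
  leaf : Bool → DTree n
  node : Fin n → DTree n → DTree n → DTree n

-- no feature repeats along any root-to-leaf path
-- (argument = features already seen on the path from the root)
NoRepeat : ∀ {n} → List (Fin n) → DTree n → Set
NoRepeat seen (leaf b) = ⊤
NoRepeat seen (node j t₀ t₁) =
  j ∉ seen × NoRepeat (j ∷ seen) t₀ × NoRepeat (j ∷ seen) t₁

ValidDTree : ∀ {n} → DTree n → Set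
ValidDTree t = NoRepeat [] t

classify : ∀ {n} → DTree n → Inst n → Bool
classify (leaf b) e = b
classify (node j t₀ t₁) e with lookup e j
... | false = classify t₀ e
... | true  = classify t₁ e

-- FOIL: first-order logic over {Pos, ⊆} (with equality),
-- formulas with free variables among Fin k (de Bruijn style)

data Formula : ℕ → Set where
  Pos   : ∀ {k} → Fin k → Formula k
  Sub   : ∀ {k} → Fin k → Fin k → Formula k
  Eq    : ∀ {k} → Fin k → Fin k → Formula k
  ¬f    : ∀ {k} → Formula k → Formula k
  _∧f_  : ∀ {k} → Formula k → Formula k → Formula k
  _∨f_  : ∀ {k} → Formula k → Formula k → Formula k
  ∃f    : ∀ {k} → Formula (suc k) → Formula k
  ∀f    : ∀ {k} → Formula (suc k) → Formula k

Assignment : ℕ → ℕ → Set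
Assignment n k = Fin k → PInst n

extend : ∀ {n k} → PInst n → Assignment n k → Assignment n (suc k)
extend d ρ zero    = d
extend d ρ (suc i) = ρ i

PosRel : ∀ {n} → Model n → PInst n → Set
PosRel {n} M e = Σ (Inst n) λ x → embed x ≡ e × M x ≡ true

Sat : ∀ {n k} → Model n → Formula k → Assignment n k → Set
Sat M (Pos i)   ρ = PosRel M (ρ i)
Sat M (Sub i j) ρ = ρ i ⊑ ρ j
Sat M (Eq i j)  ρ = ρ i ≡ ρ j
Sat M (¬f φ)    ρ = Sat M φ ρ → ⊥
Sat M (φ ∧f ψ)  ρ = Sat M φ ρ × Sat M ψ ρ
Sat M (φ ∨f ψ)  ρ = Sat M φ ρ ⊎ Sat M ψ ρ
Sat {n} M (∃f φ) ρ = Σ (PInst n) λ d → Sat M φ (extend d ρ)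
Sat {n} M (∀f φ) ρ = (d : PInst n) → Sat M φ (extend d ρ)

assign2 : ∀ {n} → PInst n → PInst n → Assignment n 2
assign2 a b zero       = a
assign2 a b (suc zero) = b

SufficientReason : ∀ {n} → DTree n → Inst n → PInst n → Set
SufficientReason {n} T e e' =
  e' ⊑ embed e ×
  ((e'' : Inst n) → e' ⊑ embed e'' → classify T e'' ≡ classify T e)

MinimumSR : ∀ {n} → DTree n → Inst n → PInst n → Set
MinimumSR {n} T e e' =
  SufficientReason T e e' ×
  ((e'' : PInst n) → SufficientReason T e e'' → countUndef e'' > countUndef e' → ⊥)

module Submission where

-- For X : Vec Bool n, the tree dnfTree X accepts an instance iff it is 1 on every feature of the
-- block X⁻¹(true) or on every feature of X⁻¹(false).  For the all-ones instance a sufficient reason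
-- must fix one whole block, so fixing the true-block is a minimum sufficient reason when both blocks
-- have m features, and is not one when the true-block has m + 1.  A formula φ cannot distinguish the
-- two situations once m is large compared to φ, by an Ehrenfeucht–Fraïssé argument.  The features of
-- the larger tree are folded onto those of the smaller, injectively except for one collapsed pair;
-- chosen partial instances are transported along the fold, which preserves Pos, ⊆ and =.  Before
-- answering a move, the collapsed pair is relocated by swapping twin features (features with the same
-- block and the same values in all chosen elements), so that afterwards it still has many twins; by
-- the pigeonhole principle over the three values {0, 1, ⊥}, each move keeps about a third of them.

open import Defs
open import Data.Bool using (Bool; true; false; not; if_then_else_)
import Data.Bool as Bool
open import Data.Bool.Properties using (¬-not; not-involutive)
open import Data.Empty using (⊥)
open import Data.Fin using (Fin; zero; suc; _≟_)
open import Data.Fin.Permutation using (Permutation′; _⟨$⟩ʳ_; _⟨$⟩ˡ_; inverseˡ; inverseʳ; transpose; _∘ₚ_)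
import Data.Fin.Permutation.Components as PC
open import Data.Fin.Properties using (any?; suc-injective)
open import Data.List using (List; []; _∷_; _++_; filter; allFin)
open import Data.List.Membership.Propositional using (_∈_; _∉_)
open import Data.List.Membership.Propositional.Properties using (∈-filter⁺; ∈-filter⁻; ∈-allFin; ∈-++⁻)
open import Data.List.Relation.Binary.Permutation.Propositional.Properties using (shift)
open import Data.List.Relation.Binary.Subset.Propositional renaming (_⊆_ to _⊆ˡ_)
open import Data.List.Relation.Binary.Subset.Propositional.Properties using (∷⁺ʳ; xs⊆ys++xs; ⊆-reflexive-↭)
open import Data.List.Relation.Unary.All as All using (All; []; _∷_)
open import Data.List.Relation.Unary.Any using (here; there)
open import Data.List.Relation.Unary.Unique.Propositional using (Unique; []; _∷_)
import Data.List.Relation.Unary.Unique.Propositional.Properties as Unique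
open import Data.Nat using (ℕ; zero; suc; _+_; _*_; _≤_; _<_; _⊔_; z≤n; s≤s; _≤?_)
open import Data.Nat.Properties
  using (≤-refl; ≤-reflexive; ≤-trans; <-≤-trans; ≤-pred; ≤⇒≯; <⇒≱; ≰⇒>; n≤1+n; m≤n+m; m≤m⊔n; m≤n⊔m;
         +-comm; +-suc; +-identityʳ; +-monoʳ-≤; +-mono-<; +-cancelˡ-≤; module ≤-Reasoning)
open import Data.Product using (Σ; ∃; ∃-syntax; _×_; _,_; proj₁; proj₂)
open import Data.Product.Function.NonDependent.Propositional using (_×-⇔_)
import Data.Product.Properties as Product
open import Data.Sum using (_⊎_; inj₁; inj₂)
import Data.Sum as Sum
open import Data.Sum.Function.Propositional using (_⊎-⇔_)
open import Data.Unit using (tt)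
open import Data.Vec using (Vec; []; _∷_; lookup; map; replicate; tabulate)
open import Data.Vec.Properties using (lookup-map; lookup-replicate; lookup∘tabulate; tabulate∘lookup; tabulate-cong)
import Data.Vec.Properties as Vec
open import Function using (_∘_; id; case_of_; _⇔_; mk⇔; Equivalence)
open import Function.Related.TypeIsomorphisms using (¬-cong-⇔)
open import Level using (0ℓ)
open import Relation.Binary.Definitions using (DecidableEquality)
open import Relation.Binary.PropositionalEquality
open import Relation.Nullary using (¬_; yes; no; does; contradiction; _×-dec_)
open import Relation.Nullary.Decidable using (dec-true; dec-false)
open import Relation.Unary using (Pred; Decidable; _⊆_; _∪_; _∩_; ∁)
open import Relation.Unary.Properties using (∅?; _∩?_; _∪?_; ∁?)

private
  variable
    A : Set
    k m n N : ℕ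
    P Q R : Pred (Fin N) 0ℓ

_≟ᵛ_ : DecidableEquality Val
v0    ≟ᵛ v0    = yes refl
v1    ≟ᵛ v1    = yes refl
undef ≟ᵛ undef = yes refl
v0    ≟ᵛ v1    = no λ ()
v0    ≟ᵛ undef = no λ ()
v1    ≟ᵛ v0    = no λ ()
v1    ≟ᵛ undef = no λ ()
undef ≟ᵛ v0    = no λ ()
undef ≟ᵛ v1    = no λ ()

count : {P : Pred (Fin N) 0ℓ} → Decidable P → ℕ
count {zero}  P? = 0
count {suc N} P? = (if does (P? zero) then suc else id) (count (P? ∘ suc))

count-⊆-∪ : (P? : Decidable P) (Q? : Decidable Q) (R? : Decidable R) →
            P ⊆ Q ∪ R → count P? ≤ count Q? + count R?
count-⊆-∪ {zero}  _  _  _  _ = z≤n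
count-⊆-∪ {suc N} P? Q? R? P⊆Q∪R
  with P? zero | Q? zero | R? zero | count-⊆-∪ (P? ∘ suc) (Q? ∘ suc) (R? ∘ suc) P⊆Q∪R
... | no _  | no _  | no _  | ih = ih
... | no _  | no _  | yes _ | ih = ≤-trans ih (+-monoʳ-≤ _ (n≤1+n _))
... | no _  | yes _ | no _  | ih = ≤-trans ih (n≤1+n _)
... | no _  | yes _ | yes _ | ih = ≤-trans ih (≤-trans (+-monoʳ-≤ _ (n≤1+n _)) (n≤1+n _))
... | yes _ | yes _ | no _  | ih = s≤s ih
... | yes _ | yes _ | yes _ | ih = s≤s (≤-trans ih (+-monoʳ-≤ _ (n≤1+n _)))
... | yes _ | no _  | yes _ | ih = ≤-trans (s≤s ih) (≤-reflexive (sym (+-suc _ _)))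
... | yes p | no ¬q | no ¬r | _  with P⊆Q∪R p
...   | inj₁ q = contradiction q ¬q
...   | inj₂ r = contradiction r ¬r

count-∅ : count (∅? {A = Fin N}) ≡ 0
count-∅ {zero}  = refl
count-∅ {suc N} = count-∅ {N}

count-mono : (P? : Decidable P) (Q? : Decidable Q) → P ⊆ Q → count P? ≤ count Q?
count-mono {N} P? Q? P⊆Q = begin
  count P?                           ≤⟨ count-⊆-∪ P? Q? ∅? (inj₁ ∘ P⊆Q) ⟩
  count Q? + count (∅? {A = Fin N})  ≡⟨ cong (count Q? +_) (count-∅ {N}) ⟩
  count Q? + 0                       ≡⟨ +-identityʳ _ ⟩
  count Q?                           ∎
  where open ≤-Reasoning

count-witness : (P? : Decidable P) → 1 ≤ count P? → ∃ P
count-witness {suc N} P? 1≤c with P? zero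
... | yes p = zero , p
... | no _ with count-witness (P? ∘ suc) 1≤c
...   | j , p = suc j , p

count-singleton : (a : Fin N) → count (_≟ a) ≤ 1
count-singleton {suc N} zero = s≤s (begin
  count (λ (j : Fin N) → suc j ≟ zero)  ≤⟨ count-mono (λ j → suc j ≟ zero) (∅? {A = Fin N}) (λ ()) ⟩
  count (∅? {A = Fin N})                ≡⟨ count-∅ {N} ⟩
  0                                     ∎)
  where open ≤-Reasoning
count-singleton (suc a) = ≤-trans (count-mono _ (_≟ a) suc-injective) (count-singleton a)

_∖?_ : Decidable P → (a : Fin N) → Decidable (P ∩ ∁ (_≡ a))
P? ∖? a = P? ∩? ∁? (_≟ a)

count-∖ : (P? : Decidable P) (a : Fin N) → count P? ≤ suc (count (P? ∖? a))
count-∖ {P = P} P? a = begin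
  count P?                          ≤⟨ count-⊆-∪ P? (P? ∖? a) (_≟ a) split ⟩
  count (P? ∖? a) + count (_≟ a)    ≤⟨ +-monoʳ-≤ _ (count-singleton a) ⟩
  count (P? ∖? a) + 1               ≡⟨ +-comm _ 1 ⟩
  suc (count (P? ∖? a))             ∎
  where
  open ≤-Reasoning
  split : P ⊆ (P ∩ ∁ (_≡ a)) ∪ (_≡ a)
  split {j} p with j ≟ a
  ... | yes j≡a = inj₂ j≡a
  ... | no j≢a  = inj₁ (p , j≢a)

pigeonhole-Val : ∀ t (P? : Decidable P) (w : Fin N → Val) → 3 * t ≤ count P? →
                 ∃ λ v → t ≤ count (P? ∩? λ j → w j ≟ᵛ v)
pigeonhole-Val {P = P} t P? w 3t≤c
  with t ≤? count (P? ∩? λ j → w j ≟ᵛ v0)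
     | t ≤? count (P? ∩? λ j → w j ≟ᵛ v1)
     | t ≤? count (P? ∩? λ j → w j ≟ᵛ undef)
... | yes t≤c₀ | _        | _        = v0 , t≤c₀
... | no _     | yes t≤c₁ | _        = v1 , t≤c₁
... | no _     | no _     | yes t≤c₂ = undef , t≤c₂
... | no c₀≱t  | no c₁≱t  | no c₂≱t  = contradiction 3t≤c (<⇒≱ (begin-strict
  count P?                                         ≤⟨ count-⊆-∪ P? (C v0) (C v1 ∪? C undef) by-value ⟩
  count (C v0) + count (C v1 ∪? C undef)           ≤⟨ +-monoʳ-≤ _ (count-⊆-∪ (C v1 ∪? C undef) (C v1) (C undef) id) ⟩
  count (C v0) + (count (C v1) + count (C undef))  <⟨ +-mono-< (≰⇒> c₀≱t) (+-mono-< (≰⇒> c₁≱t) c₂<t+0) ⟩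
  3 * t                                            ∎))
  where
  open ≤-Reasoning
  C : (v : Val) → Decidable (P ∩ λ j → w j ≡ v)
  C v = P? ∩? λ j → w j ≟ᵛ v
  c₂<t+0 : count (C undef) < t + 0
  c₂<t+0 = <-≤-trans (≰⇒> c₂≱t) (≤-reflexive (sym (+-identityʳ t)))
  by-value : P ⊆ (P ∩ λ j → w j ≡ v0) ∪ ((P ∩ λ j → w j ≡ v1) ∪ (P ∩ λ j → w j ≡ undef))
  by-value {j} p with w j
  ... | v0    = inj₁ (p , refl)
  ... | v1    = inj₂ (inj₁ (p , refl))
  ... | undef = inj₂ (inj₂ (p , refl))

testAll : List (Fin n) → DTree n → DTree n → DTree n
testAll []      t u = t
testAll (j ∷ L) t u = node j u (testAll L t u)

Ones : Inst n → Pred (Fin n) 0ℓ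
Ones x j = lookup x j ≡ true

classify-testAll : ∀ L (t u : DTree n) x →
  All (Ones x) L × classify (testAll L t u) x ≡ classify t x ⊎
  ¬ All (Ones x) L × classify (testAll L t u) x ≡ classify u x
classify-testAll []      t u x = inj₁ ([] , refl)
classify-testAll (j ∷ L) t u x with lookup x j in xⱼ
... | false = inj₂ ((λ { (xⱼ≡1 ∷ _) → contradiction (trans (sym xⱼ) xⱼ≡1) λ () }) , refl)
... | true with classify-testAll L t u x
...   | inj₁ (ones , c)  = inj₁ (xⱼ ∷ ones , c)
...   | inj₂ (¬ones , c) = inj₂ ((λ { (_ ∷ ones) → ¬ones ones }) , c)

block : Vec Bool n → Bool → List (Fin n)
block {n} X b = filter (λ j → lookup X j Bool.≟ b) (allFin n)

dnfTree : Vec Bool n → DTree n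
dnfTree X = testAll (block X true) (leaf true) (testAll (block X false) (leaf true) (leaf false))

OnesOn : Vec Bool n → Bool → Inst n → Set
OnesOn X b x = ∀ j → lookup X j ≡ b → lookup x j ≡ true

Accepts : Vec Bool n → Inst n → Set
Accepts X x = OnesOn X true x ⊎ OnesOn X false x

OnesOn⇒Accepts : ∀ {X : Vec Bool n} {x} b → OnesOn X b x → Accepts X x
OnesOn⇒Accepts true  = inj₁
OnesOn⇒Accepts false = inj₂

All-Ones-block : ∀ (X : Vec Bool n) b x → All (Ones x) (block X b) ⇔ OnesOn X b x
All-Ones-block {n} X b x = mk⇔
  (λ ones j Xⱼ≡b → All.lookup ones (∈-filter⁺ (λ j → lookup X j Bool.≟ b) (∈-allFin j) Xⱼ≡b))
  (λ ones → All.tabulate λ {j} j∈ → ones j (proj₂ (∈-filter⁻ (λ j → lookup X j Bool.≟ b) {xs = allFin n} j∈)))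

dnfTree-accepts : ∀ (X : Vec Bool n) x → classify (dnfTree X) x ≡ true ⇔ Accepts X x
dnfTree-accepts X x = mk⇔ accepted positive
  where
  module Block b = Equivalence (All-Ones-block X b x)
  inner : DTree _
  inner = testAll (block X false) (leaf true) (leaf false)
  accepted : classify (dnfTree X) x ≡ true → Accepts X x
  accepted pos with classify-testAll (block X true) (leaf true) inner x
  ... | inj₁ (ones , _) = inj₁ (Block.to true ones)
  ... | inj₂ (_ , c) with classify-testAll (block X false) (leaf true) (leaf false) x
  ...   | inj₁ (ones , _) = inj₂ (Block.to false ones)
  ...   | inj₂ (_ , c′)   = contradiction (trans (sym pos) (trans c c′)) λ ()
  positive : Accepts X x → classify (dnfTree X) x ≡ true
  positive acc with classify-testAll (block X true) (leaf true) inner x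
  ... | inj₁ (_ , c) = c
  ... | inj₂ (¬onesᵗ , c) with classify-testAll (block X false) (leaf true) (leaf false) x
  ...   | inj₁ (_ , c′) = trans c c′
  ...   | inj₂ (¬onesᶠ , _) with acc
  ...     | inj₁ onesᵗ = contradiction (Block.from true onesᵗ) ¬onesᵗ
  ...     | inj₂ onesᶠ = contradiction (Block.from false onesᶠ) ¬onesᶠ

NoRepeat-⊆ : ∀ {seen seen′} (t : DTree n) → seen′ ⊆ˡ seen → NoRepeat seen t → NoRepeat seen′ t
NoRepeat-⊆ (leaf _)       _   _                = tt
NoRepeat-⊆ (node j t₀ t₁) sub (j∉ , nr₀ , nr₁) =
  j∉ ∘ sub , NoRepeat-⊆ t₀ (∷⁺ʳ j sub) nr₀ , NoRepeat-⊆ t₁ (∷⁺ʳ j sub) nr₁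

testAll-NoRepeat : ∀ {seen L} (t u : DTree n) → Unique L → All (_∉ seen) L →
  NoRepeat (L ++ seen) t → NoRepeat (L ++ seen) u → NoRepeat seen (testAll L t u)
testAll-NoRepeat {L = []} t u _ _ nrₜ _ = nrₜ
testAll-NoRepeat {seen = seen} {j ∷ L} t u (j∉L ∷ unique) (j∉ ∷ L∉) nrₜ nrᵤ =
  j∉ , NoRepeat-⊆ u (∷⁺ʳ j (xs⊆ys++xs seen L)) nrᵤ ,
  testAll-NoRepeat t u unique (All.zipWith fresh (j∉L , L∉)) (NoRepeat-⊆ t moved nrₜ) (NoRepeat-⊆ u moved nrᵤ)
  where
  moved : L ++ j ∷ seen ⊆ˡ j ∷ L ++ seen
  moved = ⊆-reflexive-↭ (shift j L seen)
  fresh : ∀ {i} → j ≢ i × i ∉ seen → i ∉ j ∷ seen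
  fresh (j≢i , _)  (here i≡j) = j≢i (sym i≡j)
  fresh (_ , i∉)   (there i∈) = i∉ i∈

dnfTree-valid : (X : Vec Bool n) → ValidDTree (dnfTree X)
dnfTree-valid {n} X =
  testAll-NoRepeat (leaf true) _ (block-unique true) (All.universal (λ _ ()) _) tt
    (testAll-NoRepeat (leaf true) (leaf false) (block-unique false) (All.tabulate disjoint) tt tt)
  where
  block-unique : ∀ b → Unique (block X b)
  block-unique b = Unique.filter⁺ (λ j → lookup X j Bool.≟ b) (Unique.allFin⁺ n)
  in-block : ∀ {b j} → j ∈ block X b → lookup X j ≡ b
  in-block {b} j∈ = proj₂ (∈-filter⁻ (λ j → lookup X j Bool.≟ b) {xs = allFin n} j∈)
  disjoint : ∀ {j} → j ∈ block X false → j ∉ block X true ++ []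
  disjoint j∈ᶠ j∈ᵗ with ∈-++⁻ (block X true) j∈ᵗ
  ... | inj₁ j∈ = contradiction (trans (sym (in-block j∈ᶠ)) (in-block j∈)) λ ()

ones : Inst n
ones {n} = replicate n true

occurrences : Bool → Vec Bool n → ℕ
occurrences b X = count (λ j → lookup X j Bool.≟ b)

pin : Bool → Bool → Val
pin true  true  = v1
pin false false = v1
pin true  false = undef
pin false true  = undef

blockReason : Bool → Vec Bool n → PInst n
blockReason b = map (pin b)

countUndef-blockReason : ∀ b (X : Vec Bool n) → countUndef (blockReason b X) ≡ occurrences (not b) X
countUndef-blockReason b     []          = refl
countUndef-blockReason true  (true ∷ X)  = countUndef-blockReason true X
countUndef-blockReason true  (false ∷ X) = cong suc (countUndef-blockReason true X)
countUndef-blockReason false (true ∷ X)  = cong suc (countUndef-blockReason false X)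
countUndef-blockReason false (false ∷ X) = countUndef-blockReason false X

countUndef-count : (e : PInst n) → countUndef e ≡ count (λ j → lookup e j ≟ᵛ undef)
countUndef-count []          = refl
countUndef-count (v0 ∷ e)    = countUndef-count e
countUndef-count (v1 ∷ e)    = countUndef-count e
countUndef-count (undef ∷ e) = cong suc (countUndef-count e)

lookup-embed : ∀ (x : Inst n) j → lookup (embed x) j ≡ toVal (lookup x j)
lookup-embed x j = lookup-map j toVal x

toVal-v1 : ∀ {b} → toVal b ≡ v1 → b ≡ true
toVal-v1 {true} _ = refl

lookup-embed-ones : ∀ (j : Fin n) → lookup (embed ones) j ≡ v1
lookup-embed-ones j = trans (lookup-embed ones j) (cong toVal (lookup-replicate j true))

defined-in-ones : ∀ (e : PInst n) j → e ⊑ embed ones → lookup e j ≢ undef → lookup e j ≡ v1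
defined-in-ones e j e⊑1 eⱼ≢⊥ = trans (e⊑1 j eⱼ≢⊥) (lookup-embed-ones j)

completion-one : ∀ (e : PInst n) x j → e ⊑ embed x → lookup e j ≡ v1 → lookup x j ≡ true
completion-one e x j e⊑x eⱼ≡1 = toVal-v1 (begin
  toVal (lookup x j)       ≡⟨ lookup-embed x j ⟨
  lookup (embed x) j       ≡⟨ e⊑x j (λ eⱼ≡⊥ → contradiction (trans (sym eⱼ≡1) eⱼ≡⊥) λ ()) ⟨
  lookup e j               ≡⟨ eⱼ≡1 ⟩
  v1                       ∎)
  where open ≡-Reasoning

ones-accepted : (X : Vec Bool n) → classify (dnfTree X) ones ≡ true
ones-accepted X = Equivalence.from (dnfTree-accepts X ones) (inj₁ λ j _ → lookup-replicate j true)

pin-defined : ∀ b x → pin b x ≢ undef → pin b x ≡ v1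
pin-defined true  true  _ = refl
pin-defined false false _ = refl
pin-defined true  false u = contradiction refl u
pin-defined false true  u = contradiction refl u

pin-same : ∀ {b x} → x ≡ b → pin b x ≡ v1
pin-same {true}  refl = refl
pin-same {false} refl = refl

blockReason-sufficient : ∀ b (X : Vec Bool n) → SufficientReason (dnfTree X) ones (blockReason b X)
blockReason-sufficient b X = subsumed , λ x br⊑x → trans (accepted x br⊑x) (sym (ones-accepted X))
  where
  lookup-br : ∀ j → lookup (blockReason b X) j ≡ pin b (lookup X j)
  lookup-br j = lookup-map j (pin b) X
  subsumed : blockReason b X ⊑ embed ones
  subsumed j brⱼ≢⊥ =
    trans (trans (lookup-br j) (pin-defined b _ (brⱼ≢⊥ ∘ trans (lookup-br j)))) (sym (lookup-embed-ones j))
  accepted : ∀ x → blockReason b X ⊑ embed x → classify (dnfTree X) x ≡ true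
  accepted x br⊑x = Equivalence.from (dnfTree-accepts X x) (OnesOn⇒Accepts {X = X} {x} b λ j Xⱼ≡b →
    completion-one (blockReason b X) x j br⊑x (trans (lookup-br j) (pin-same Xⱼ≡b)))

isOne : Val → Bool
isOne v1 = true
isOne _  = false

zeroFill : PInst n → Inst n
zeroFill = map isOne

zeroFill-undef : ∀ (e : PInst n) j → lookup e j ≡ undef → lookup (zeroFill e) j ≢ true
zeroFill-undef e j eⱼ≡⊥ xⱼ≡1 = contradiction (trans (sym (trans (lookup-map j isOne e) (cong isOne eⱼ≡⊥))) xⱼ≡1) λ ()

zeroFill-completes : ∀ (e : PInst n) → e ⊑ embed ones → e ⊑ embed (zeroFill e)
zeroFill-completes e e⊑1 j eⱼ≢⊥ = begin
  lookup e j                    ≡⟨ eⱼ≡1 ⟩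
  v1                            ≡⟨ cong (toVal ∘ isOne) (sym eⱼ≡1) ⟩
  toVal (isOne (lookup e j))    ≡⟨ cong toVal (lookup-map j isOne e) ⟨
  toVal (lookup (zeroFill e) j) ≡⟨ lookup-embed (zeroFill e) j ⟨
  lookup (embed (zeroFill e)) j ∎
  where
  open ≡-Reasoning
  eⱼ≡1 : lookup e j ≡ v1
  eⱼ≡1 = defined-in-ones e j e⊑1 eⱼ≢⊥

-- If they met both blocks, the completion zeroFill e would be 0 on a feature of each block, hence rejected.
undefined-in-one-block : ∀ {X : Vec Bool n} {e} → SufficientReason (dnfTree X) ones e →
                         ∃ λ b → ∀ j → lookup e j ≡ undef → lookup X j ≡ b
undefined-in-one-block {X = X} {e} (e⊑1 , sufficient)
  with any? (λ j → (lookup e j ≟ᵛ undef) ×-dec (lookup X j Bool.≟ true))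
... | no ¬mixed = false , λ j eⱼ≡⊥ → ¬-not (λ Xⱼ≡1 → ¬mixed (j , eⱼ≡⊥ , Xⱼ≡1))
... | yes (j₁ , e₁≡⊥ , X₁≡1) = true , λ j eⱼ≡⊥ → ¬-not λ Xⱼ≡0 → case accepted of λ
    { (inj₁ onesᵗ) → zeroFill-undef e j₁ e₁≡⊥ (onesᵗ j₁ X₁≡1)
    ; (inj₂ onesᶠ) → zeroFill-undef e j eⱼ≡⊥ (onesᶠ j Xⱼ≡0) }
  where
  accepted : Accepts X (zeroFill e)
  accepted = Equivalence.to (dnfTree-accepts X (zeroFill e))
    (trans (sufficient (zeroFill e) (zeroFill-completes e e⊑1)) (ones-accepted X))

sufficientReason-countUndef : ∀ (X : Vec Bool n) e → SufficientReason (dnfTree X) ones e →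
                              ∃ λ b → countUndef e ≤ occurrences b X
sufficientReason-countUndef X e sr with undefined-in-one-block {X = X} {e} sr
... | b , in-block = b , (begin
  countUndef e                       ≡⟨ countUndef-count e ⟩
  count (λ j → lookup e j ≟ᵛ undef)  ≤⟨ count-mono _ (λ j → lookup X j Bool.≟ b) (in-block _) ⟩
  occurrences b X                    ∎)
  where open ≤-Reasoning

blockReason-minimum : ∀ b (X : Vec Bool n) → occurrences b X ≤ occurrences (not b) X →
                      MinimumSR (dnfTree X) ones (blockReason b X)
blockReason-minimum b X b≤¬b = blockReason-sufficient b X , λ e sr more →
  let c , bound = sufficientReason-countUndef X e sr in
  ≤⇒≯ (≤-trans bound (largest b c b≤¬b)) (subst (_< countUndef e) (countUndef-blockReason b X) more)
  where
  largest : ∀ a c → occurrences a X ≤ occurrences (not a) X → occurrences c X ≤ occurrences (not a) X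
  largest true  true  a≤¬a = a≤¬a
  largest false false a≤¬a = a≤¬a
  largest true  false _    = ≤-refl
  largest false true  _    = ≤-refl

blockReason-not-minimum : ∀ b (X : Vec Bool n) → occurrences (not b) X < occurrences b X →
                          ¬ MinimumSR (dnfTree X) ones (blockReason b X)
blockReason-not-minimum b X ¬b<b (_ , minimal) =
  minimal (blockReason (not b) X) (blockReason-sufficient (not b) X) (begin-strict
    countUndef (blockReason b X)        ≡⟨ countUndef-blockReason b X ⟩
    occurrences (not b) X               <⟨ ¬b<b ⟩
    occurrences b X                     ≡⟨ cong (λ c → occurrences c X) (not-involutive b) ⟨
    occurrences (not (not b)) X         ≡⟨ countUndef-blockReason (not b) X ⟨
    countUndef (blockReason (not b) X)  ∎)
  where open ≤-Reasoning

balanced : (m : ℕ) → Vec Bool (m * 2)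
balanced zero    = []
balanced (suc m) = true ∷ false ∷ balanced m

occurrences-balanced : ∀ b m → occurrences b (balanced m) ≡ m
occurrences-balanced b     zero    = refl
occurrences-balanced true  (suc m) = cong suc (occurrences-balanced true m)
occurrences-balanced false (suc m) = cong suc (occurrences-balanced false m)

record Reindexed (g : Fin m → Fin n) (u : Vec A n) (u′ : Vec A m) : Set where
  constructor reindexed
  field
    at : ∀ j → lookup u′ j ≡ lookup u (g j)

open Reindexed public

reindex : (Fin m → Fin n) → Vec A n → Vec A m
reindex g u = tabulate (lookup u ∘ g)

reindex-Reindexed : ∀ (g : Fin m → Fin n) (u : Vec A n) → Reindexed g u (reindex g u)
reindex-Reindexed g u = reindexed (lookup∘tabulate (lookup u ∘ g))

Reindexed-section : ∀ {g : Fin m → Fin n} {s} {u : Vec A n} {u′} →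
                    (∀ a → g (s a) ≡ a) → Reindexed g u u′ → Reindexed s u′ u
Reindexed-section {u = u} g∘s r = reindexed λ a → trans (cong (lookup u) (sym (g∘s a))) (sym (at r _))

lookup-ext : ∀ {u v : Vec A n} → (∀ j → lookup u j ≡ lookup v j) → u ≡ v
lookup-ext {u = u} {v} eq = trans (sym (tabulate∘lookup u)) (trans (tabulate-cong eq) (tabulate∘lookup v))

module _ {g : Fin m → Fin n} {u v : PInst n} {u′ v′ : PInst m}
         (ru : Reindexed g u u′) (rv : Reindexed g v v′) where

  ⊑-reindex : u ⊑ v → u′ ⊑ v′
  ⊑-reindex u⊑v j u′ⱼ≢⊥ = trans (at ru j) (trans (u⊑v (g j) (u′ⱼ≢⊥ ∘ trans (at ru j))) (sym (at rv j)))

  ≡-reindex : u ≡ v → u′ ≡ v′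
  ≡-reindex refl = lookup-ext λ j → trans (at ru j) (sym (at rv j))

Accepts-reindex : ∀ {g : Fin m → Fin n} {X Y} → Reindexed g X Y → ∀ x → Accepts X x → Accepts Y (reindex g x)
Accepts-reindex {g = g} {X} {Y} rX x = Sum.map OnesOn-reindex OnesOn-reindex
  where
  OnesOn-reindex : ∀ {b} → OnesOn X b x → OnesOn Y b (reindex g x)
  OnesOn-reindex onesOn j Yⱼ≡b = trans (at (reindex-Reindexed g x) j) (onesOn (g j) (trans (sym (at rX j)) Yⱼ≡b))

embed-reindex : ∀ {g : Fin m → Fin n} {x u′} → Reindexed g (embed x) u′ → embed (reindex g x) ≡ u′
embed-reindex {g = g} {x} {u′} r = lookup-ext λ j → begin
  lookup (embed (reindex g x)) j   ≡⟨ lookup-map j toVal (reindex g x) ⟩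
  toVal (lookup (reindex g x) j)   ≡⟨ cong toVal (at (reindex-Reindexed g x) j) ⟩
  toVal (lookup x (g j))           ≡⟨ lookup-map (g j) toVal x ⟨
  lookup (embed x) (g j)           ≡⟨ at r j ⟨
  lookup u′ j                      ∎
  where open ≡-Reasoning

PosRel-reindex : ∀ {g : Fin m → Fin n} {X Y u u′} → Reindexed g X Y → Reindexed g u u′ →
                 PosRel (classify (dnfTree X)) u → PosRel (classify (dnfTree Y)) u′
PosRel-reindex {g = g} {X} {Y} rX ru (x , refl , pos) =
  reindex g x , embed-reindex ru ,
  Equivalence.from (dnfTree-accepts Y _) (Accepts-reindex rX x (Equivalence.to (dnfTree-accepts X x) pos))

Profile : ℕ → Set
Profile k = Bool × Vec Val k

profile : Vec Bool n → Assignment n k → Fin n → Profile k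
profile X ρ j = lookup X j , tabulate λ i → lookup (ρ i) j

_≟ᵖ_ : DecidableEquality (Profile k)
_≟ᵖ_ = Product.≡-dec Bool._≟_ (Vec.≡-dec _≟ᵛ_)

module _ {X : Vec Bool m} {Y : Vec Bool n} {ρ : Assignment m k} {σ : Assignment n k} {j a}
         (same : profile X ρ j ≡ profile Y σ a) where

  profile-label : lookup X j ≡ lookup Y a
  profile-label = cong proj₁ same

  profile-row : ∀ i → lookup (ρ i) j ≡ lookup (σ i) a
  profile-row i = begin
    lookup (ρ i) j                                         ≡⟨ lookup∘tabulate (λ i → lookup (ρ i) j) i ⟨
    lookup (proj₂ (profile X ρ j)) i                       ≡⟨ cong (λ p → lookup (proj₂ p) i) same ⟩
    lookup (proj₂ (profile Y σ a)) i                       ≡⟨ lookup∘tabulate (λ i → lookup (σ i) a) i ⟩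
    lookup (σ i) a                                         ∎
    where open ≡-Reasoning

  profile-extend : ∀ {d d′} → lookup d j ≡ lookup d′ a → profile X (extend d ρ) j ≡ profile Y (extend d′ σ) a
  profile-extend dⱼ≡d′ₐ = cong₂ (λ p v → proj₁ p , v ∷ proj₂ p) same dⱼ≡d′ₐ

transpose-left : ∀ (i j : Fin n) → PC.transpose i j i ≡ j
transpose-left i j rewrite dec-true (i ≟ i) refl = refl

transpose-other : ∀ {i j k : Fin n} → k ≢ i → k ≢ j → PC.transpose i j k ≡ k
transpose-other {i = i} {j} {k} k≢i k≢j rewrite dec-false (k ≟ i) k≢i | dec-false (k ≟ j) k≢j = refl

transpose-invariant : ∀ (f : Fin n → A) {i j} → f i ≡ f j → ∀ k → f (PC.transpose i j k) ≡ f k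
transpose-invariant f {i} {j} fi≡fj k with k ≟ i
... | yes refl = sym fi≡fj
... | no _ with k ≟ j
...   | yes refl = fi≡fj
...   | no _     = refl

record Folding (m n : ℕ) : Set where
  field
    fold        : Fin m → Fin n
    unfold      : Fin n → Fin m
    rep dup     : Fin m
    rep≢dup     : rep ≢ dup
    fold-unfold : ∀ a → fold (unfold a) ≡ a
    unfold-fold : ∀ j → j ≢ dup → unfold (fold j) ≡ j
    fold-dup    : fold dup ≡ fold rep

  fold-injective : ∀ {j j′} → j ≢ dup → j′ ≢ dup → fold j ≡ fold j′ → j ≡ j′
  fold-injective {j} {j′} j≢dup j′≢dup eq =
    trans (sym (unfold-fold j j≢dup)) (trans (cong unfold eq) (unfold-fold j′ j′≢dup))

  unfold-fold-agrees : ∀ (u : Vec A m) → lookup u dup ≡ lookup u rep → ∀ j → lookup u (unfold (fold j)) ≡ lookup u j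
  unfold-fold-agrees u uₐ≡uᵣ j with j ≟ dup
  ... | no j≢dup = cong (lookup u) (unfold-fold j j≢dup)
  ... | yes refl =
    trans (cong (lookup u ∘ unfold) fold-dup) (trans (cong (lookup u) (unfold-fold rep rep≢dup)) (sym uₐ≡uᵣ))

open Folding

postcompose : Folding m n → Permutation′ n → Folding m n
postcompose F σ = record
  { fold        = (σ ⟨$⟩ʳ_) ∘ fold F
  ; unfold      = unfold F ∘ (σ ⟨$⟩ˡ_)
  ; rep         = rep F
  ; dup         = dup F
  ; rep≢dup     = rep≢dup F
  ; fold-unfold = λ a → trans (cong (σ ⟨$⟩ʳ_) (fold-unfold F _)) (inverseʳ σ)
  ; unfold-fold = λ j j≢dup → trans (cong (unfold F) (inverseˡ σ)) (unfold-fold F j j≢dup)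
  ; fold-dup    = cong (σ ⟨$⟩ʳ_) (fold-dup F)
  }

precompose : Folding m n → Permutation′ m → Folding m n
precompose F τ = record
  { fold        = fold F ∘ (τ ⟨$⟩ˡ_)
  ; unfold      = (τ ⟨$⟩ʳ_) ∘ unfold F
  ; rep         = τ ⟨$⟩ʳ rep F
  ; dup         = τ ⟨$⟩ʳ dup F
  ; rep≢dup     = λ eq → rep≢dup F (trans (sym (inverseˡ τ)) (trans (cong (τ ⟨$⟩ˡ_) eq) (inverseˡ τ)))
  ; fold-unfold = λ a → trans (cong (fold F) (inverseˡ τ)) (fold-unfold F a)
  ; unfold-fold = λ j j≢dup → trans (cong (τ ⟨$⟩ʳ_)
                    (unfold-fold F _ λ eq → j≢dup (trans (sym (inverseʳ τ)) (cong (τ ⟨$⟩ʳ_) eq)))) (inverseʳ τ)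
  ; fold-dup    = trans (cong (fold F) (inverseˡ τ)) (trans (fold-dup F) (cong (fold F) (sym (inverseˡ τ))))
  }

-- A move keeps the twins on which the new element takes its majority value (a third of them), except
-- for at most three features involved in the relocation.
threshold : Formula k → ℕ
threshold (Pos _)   = 0
threshold (Sub _ _) = 0
threshold (Eq _ _)  = 0
threshold (¬f φ)    = threshold φ
threshold (φ ∧f ψ)  = threshold φ ⊔ threshold ψ
threshold (φ ∨f ψ)  = threshold φ ⊔ threshold ψ
threshold (∃f φ)    = 3 * (3 + threshold φ)
threshold (∀f φ)    = 3 * (3 + threshold φ)

module Game {NA NB : ℕ} (XA : Vec Bool NA) (XB : Vec Bool NB) where

  MA : Model NA
  MA = classify (dnfTree XA)

  MB : Model NB
  MB = classify (dnfTree XB)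

  Folds : Folding NB NA → Assignment NA k → Assignment NB k → Set
  Folds F ρ ρ′ = ∀ j → profile XB ρ′ j ≡ profile XA ρ (fold F j)

  Twin : Assignment NB k → Fin NB → Pred (Fin NB) 0ℓ
  Twin ρ′ h j = profile XB ρ′ j ≡ profile XB ρ′ h

  twin? : (ρ′ : Assignment NB k) (h : Fin NB) → Decidable (Twin ρ′ h)
  twin? ρ′ h j = profile XB ρ′ j ≟ᵖ profile XB ρ′ h

  record Matches (t : ℕ) (ρ : Assignment NA k) (ρ′ : Assignment NB k) : Set where
    field
      folding : Folding NB NA
      folds   : Folds folding ρ ρ′
      twins   : t ≤ count (twin? ρ′ (rep folding))

  Matches-weaken : ∀ {t t′} {ρ : Assignment NA k} {ρ′} → t′ ≤ t → Matches t ρ ρ′ → Matches t′ ρ ρ′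
  Matches-weaken t′≤t M = record { Matches M ; twins = ≤-trans t′≤t (Matches.twins M) }

  Folds-extend : ∀ {F} {ρ : Assignment NA k} {ρ′ d d′} → Folds F ρ ρ′ → Reindexed (fold F) d d′ →
                 Folds F (extend d ρ) (extend d′ ρ′)
  Folds-extend {F = F} {ρ} {ρ′} {d} {d′} folds r j =
    profile-extend {X = XB} {XA} {ρ′} {ρ} {j} {fold F j} (folds j) {d′} {d} (at r j)

  Folds-postcompose : ∀ {F} {ρ : Assignment NA k} {ρ′} (σ : Permutation′ NA) →
                      (∀ a → profile XA ρ (σ ⟨$⟩ʳ a) ≡ profile XA ρ a) →
                      Folds F ρ ρ′ → Folds (postcompose F σ) ρ ρ′
  Folds-postcompose {F = F} σ invariant folds j = trans (folds j) (sym (invariant (fold F j)))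

  Folds-precompose : ∀ {F} {ρ : Assignment NA k} {ρ′} (τ : Permutation′ NB) →
                     (∀ j → profile XB ρ′ (τ ⟨$⟩ˡ j) ≡ profile XB ρ′ j) →
                     Folds F ρ ρ′ → Folds (precompose F τ) ρ ρ′
  Folds-precompose τ invariant folds j = trans (sym (invariant j)) (folds (τ ⟨$⟩ˡ j))

  module Atoms {t} {ρ : Assignment NA k} {ρ′} (M : Matches t ρ ρ′) where
    open Matches M renaming (folding to F)

    labels : Reindexed (fold F) XA XB
    labels = reindexed λ j → profile-label {X = XB} {XA} {ρ′} {ρ} (folds j)

    rows : ∀ i → Reindexed (fold F) (ρ i) (ρ′ i)
    rows i = reindexed λ j → profile-row {X = XB} {XA} {ρ′} {ρ} (folds j) i

    labels⁻ : Reindexed (unfold F) XB XA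
    labels⁻ = Reindexed-section (fold-unfold F) labels

    rows⁻ : ∀ i → Reindexed (unfold F) (ρ′ i) (ρ i)
    rows⁻ i = Reindexed-section (fold-unfold F) (rows i)

    Pos-transfer : ∀ i → PosRel MA (ρ i) ⇔ PosRel MB (ρ′ i)
    Pos-transfer i = mk⇔ (PosRel-reindex labels (rows i)) (PosRel-reindex labels⁻ (rows⁻ i))

    ⊑-transfer : ∀ i i′ → ρ i ⊑ ρ i′ ⇔ ρ′ i ⊑ ρ′ i′
    ⊑-transfer i i′ = mk⇔ (⊑-reindex (rows i) (rows i′)) (⊑-reindex (rows⁻ i) (rows⁻ i′))

    ≡-transfer : ∀ i i′ → ρ i ≡ ρ i′ ⇔ ρ′ i ≡ ρ′ i′
    ≡-transfer i i′ = mk⇔ (≡-reindex (rows i) (rows i′)) (≡-reindex (rows⁻ i) (rows⁻ i′))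

  module Majority {t} {ρ : Assignment NA k} {ρ′} (M : Matches (3 * (3 + t)) ρ ρ′) (w : Fin NB → Val) where
    open Matches M renaming (folding to F)

    majority : ∃ λ v → 3 + t ≤ count (twin? ρ′ (rep F) ∩? λ j → w j ≟ᵛ v)
    majority = pigeonhole-Val (3 + t) (twin? ρ′ (rep F)) w twins

    v : Val
    v = proj₁ majority

    Class : Pred (Fin NB) 0ℓ
    Class = Twin ρ′ (rep F) ∩ λ j → w j ≡ v

    class? : Decidable Class
    class? = twin? ρ′ (rep F) ∩? λ j → w j ≟ᵛ v

    class-size : 3 + t ≤ count class?
    class-size = proj₂ majority

    pick : (a : Fin NB) → ∃ (Class ∩ ∁ (_≡ a))
    pick a = count-witness (class? ∖? a) (≤-trans (s≤s z≤n) (≤-pred (≤-trans class-size (count-∖ class? a))))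

  -- The spoiler picks d in A: the doubled feature of A is moved, by a transposition of A-twins,
  -- to one where d takes the majority value on the twins of rep.
  forth : ∀ {t} {ρ : Assignment NA k} {ρ′} → Matches (3 * (3 + t)) ρ ρ′ →
          (d : PInst NA) → ∃[ d′ ] Matches t (extend d ρ) (extend d′ ρ′)
  forth {t = t} {ρ} {ρ′} M d = d′ , record
    { folding = F′
    ; folds   = Folds-extend {F = F′} {ρ} {ρ′} (Folds-postcompose {F = F} {ρ} {ρ′} σ σ-invariant folds)
                             (reindex-Reindexed (fold F′) d)
    ; twins   = ≤-trans (+-cancelˡ-≤ 3 _ _ three-removed) (count-mono rest? (twin? (extend d′ ρ′) (rep F)) still-twin)
    }
    where
    open Matches M renaming (folding to F)
    w : Fin NB → Val
    w j = lookup d (fold F j)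
    open Majority M w
    h : Fin NB
    h = proj₁ (pick (dup F))
    h-twin : Twin ρ′ (rep F) h
    h-twin = proj₁ (proj₁ (proj₂ (pick (dup F))))
    wₕ≡v : w h ≡ v
    wₕ≡v = proj₂ (proj₁ (proj₂ (pick (dup F))))
    h≢dup : h ≢ dup F
    h≢dup = proj₂ (proj₂ (pick (dup F)))
    σ : Permutation′ NA
    σ = transpose (fold F (rep F)) (fold F h)
    F′ : Folding NB NA
    F′ = postcompose F σ
    d′ : PInst NB
    d′ = reindex (fold F′) d
    σ-invariant : ∀ a → profile XA ρ (σ ⟨$⟩ʳ a) ≡ profile XA ρ a
    σ-invariant = transpose-invariant (profile XA ρ) (trans (sym (folds (rep F))) (trans (sym h-twin) (folds h)))
    Rest : Pred (Fin NB) 0ℓ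
    Rest = ((Class ∩ ∁ (_≡ dup F)) ∩ ∁ (_≡ rep F)) ∩ ∁ (_≡ h)
    rest? : Decidable Rest
    rest? = ((class? ∖? dup F) ∖? rep F) ∖? h
    three-removed : 3 + t ≤ 3 + count rest?
    three-removed = begin
      3 + t                                    ≤⟨ class-size ⟩
      count class?                             ≤⟨ count-∖ class? (dup F) ⟩
      1 + count (class? ∖? dup F)              ≤⟨ s≤s (count-∖ (class? ∖? dup F) (rep F)) ⟩
      2 + count ((class? ∖? dup F) ∖? rep F)   ≤⟨ s≤s (s≤s (count-∖ ((class? ∖? dup F) ∖? rep F) h)) ⟩
      3 + count rest?                          ∎
      where open ≤-Reasoning
    still-twin : ∀ {j} → Rest j → Twin (extend d′ ρ′) (rep F) j
    still-twin {j} ((((j-twin , wⱼ≡v) , j≢dup) , j≢rep) , j≢h) =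
      profile-extend {X = XB} {XB} {ρ′} {ρ′} {j} {rep F} j-twin {d′} {d′} (begin
        lookup d′ j                        ≡⟨ at (reindex-Reindexed (fold F′) d) j ⟩
        lookup d (σ ⟨$⟩ʳ fold F j)         ≡⟨ cong (lookup d) (transpose-other
                                                (j≢rep ∘ fold-injective F j≢dup (rep≢dup F))
                                                (j≢h ∘ fold-injective F j≢dup h≢dup)) ⟩
        w j                                ≡⟨ trans wⱼ≡v (sym wₕ≡v) ⟩
        w h                                ≡⟨ cong (lookup d) (transpose-left (fold F (rep F)) (fold F h)) ⟨
        lookup d (σ ⟨$⟩ʳ fold F (rep F))   ≡⟨ at (reindex-Reindexed (fold F′) d) (rep F) ⟨
        lookup d′ (rep F)                  ∎)
      where open ≡-Reasoning

  -- The spoiler picks d′ in B: the collapsed pair is moved, by transpositions of B-twins, onto two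
  -- twins p, q on which d′ takes the majority value, so that d′ factors through the new fold.
  back : ∀ {t} {ρ : Assignment NA k} {ρ′} → Matches (3 * (3 + t)) ρ ρ′ →
         (d′ : PInst NB) → ∃[ d ] Matches t (extend d ρ) (extend d′ ρ′)
  back {t = t} {ρ} {ρ′} M d′ = d , record
    { folding = F′
    ; folds   = Folds-extend {F = F′} {ρ} {ρ′} (Folds-precompose {F = F} {ρ} {ρ′} τ τ-invariant folds) factors
    ; twins   = subst (λ r → t ≤ count (twin? (extend d′ ρ′) r)) (sym τ-rep)
                      (≤-trans (m≤n+m t 3) (≤-trans class-size (count-mono class? (twin? (extend d′ ρ′) p) twin-of-p)))
    }
    where
    open Matches M renaming (folding to F)
    open Majority M (lookup d′)
    p q : Fin NB
    p = proj₁ (pick (dup F))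
    q = proj₁ (pick p)
    p-class : Class p
    p-class = proj₁ (proj₂ (pick (dup F)))
    q-class : Class q
    q-class = proj₁ (proj₂ (pick p))
    p≢dup : p ≢ dup F
    p≢dup = proj₂ (proj₂ (pick (dup F)))
    q≢p : q ≢ p
    q≢p = proj₂ (proj₂ (pick p))
    τ : Permutation′ NB
    τ = transpose (rep F) p ∘ₚ transpose (dup F) q
    τ-rep : τ ⟨$⟩ʳ rep F ≡ p
    τ-rep = trans (cong (PC.transpose (dup F) q) (transpose-left (rep F) p)) (transpose-other p≢dup (q≢p ∘ sym))
    τ-dup : τ ⟨$⟩ʳ dup F ≡ q
    τ-dup = trans (cong (PC.transpose (dup F) q) (transpose-other (rep≢dup F ∘ sym) (p≢dup ∘ sym)))
                  (transpose-left (dup F) q)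
    F′ : Folding NB NA
    F′ = precompose F τ
    d : PInst NA
    d = reindex (unfold F′) d′
    dup-twin : Twin ρ′ (rep F) (dup F)
    dup-twin = trans (folds (dup F)) (trans (cong (profile XA ρ) (fold-dup F)) (sym (folds (rep F))))
    τ-invariant : ∀ j → profile XB ρ′ (τ ⟨$⟩ˡ j) ≡ profile XB ρ′ j
    τ-invariant j = trans (transpose-invariant (profile XB ρ′) (proj₁ p-class) _)
                          (transpose-invariant (profile XB ρ′) (trans (proj₁ q-class) (sym dup-twin)) j)
    factors : Reindexed (fold F′) d d′
    factors = reindexed λ j → sym (trans (at (reindex-Reindexed (unfold F′) d′) (fold F′ j))
                                         (unfold-fold-agrees F′ d′ pair-agrees j))
      where
      pair-agrees : lookup d′ (dup F′) ≡ lookup d′ (rep F′)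
      pair-agrees = trans (cong (lookup d′) τ-dup)
                          (trans (proj₂ q-class) (trans (sym (proj₂ p-class)) (cong (lookup d′) (sym τ-rep))))
    twin-of-p : ∀ {j} → Class j → Twin (extend d′ ρ′) p j
    twin-of-p {j} (j-twin , d′ⱼ≡v) =
      profile-extend {X = XB} {XB} {ρ′} {ρ′} {j} {p} (trans j-twin (sym (proj₁ p-class)))
                     {d′} {d′} (trans d′ⱼ≡v (sym (proj₂ p-class)))

  transfer : ∀ (φ : Formula k) {t ρ ρ′} → threshold φ ≤ t → Matches t ρ ρ′ → Sat MA φ ρ ⇔ Sat MB φ ρ′
  transfer (Pos i)    _ M = Atoms.Pos-transfer M i
  transfer (Sub i i′) _ M = Atoms.⊑-transfer M i i′
  transfer (Eq i i′)  _ M = Atoms.≡-transfer M i i′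
  transfer (¬f φ) φ≤t M = ¬-cong-⇔ (transfer φ φ≤t M)
  transfer (φ ∧f ψ) φψ≤t M =
    transfer φ (≤-trans (m≤m⊔n _ _) φψ≤t) M ×-⇔ transfer ψ (≤-trans (m≤n⊔m _ _) φψ≤t) M
  transfer (φ ∨f ψ) φψ≤t M =
    transfer φ (≤-trans (m≤m⊔n _ _) φψ≤t) M ⊎-⇔ transfer ψ (≤-trans (m≤n⊔m _ _) φψ≤t) M
  transfer (∃f φ) φ≤t M = mk⇔
    (λ (d , sat) → let d′ , M′ = forth (Matches-weaken φ≤t M) d in d′ , Equivalence.to (transfer φ ≤-refl M′) sat)
    (λ (d′ , sat) → let d , M′ = back (Matches-weaken φ≤t M) d′ in d , Equivalence.from (transfer φ ≤-refl M′) sat)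
  transfer (∀f φ) φ≤t M = mk⇔
    (λ sat d′ → let d , M′ = back (Matches-weaken φ≤t M) d′ in Equivalence.to (transfer φ ≤-refl M′) (sat d))
    (λ sat d → let d′ , M′ = forth (Matches-weaken φ≤t M) d in Equivalence.from (transfer φ ≤-refl M′) (sat d′))

duplicateHead : Folding (suc (suc n)) (suc n)
duplicateHead = record
  { fold        = λ { zero → zero ; (suc j) → j }
  ; unfold      = suc
  ; rep         = suc zero
  ; dup         = zero
  ; rep≢dup     = λ ()
  ; fold-unfold = λ _ → refl
  ; unfold-fold = λ { zero 0≢0 → contradiction refl 0≢0 ; (suc j) _ → refl }
  ; fold-dup    = refl
  }

profile-blockReason : ∀ b (X : Vec Bool n) j →
  profile X (assign2 (embed ones) (blockReason b X)) j ≡ (lookup X j , v1 ∷ pin b (lookup X j) ∷ [])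
profile-blockReason b X j = cong₂ (λ u v → lookup X j , u ∷ v ∷ []) (lookup-embed-ones j) (lookup-map j (pin b) X)

duplicateHead-Matches : ∀ b x (X : Vec Bool n) →
  Game.Matches (x ∷ X) (x ∷ x ∷ X) (occurrences x (x ∷ x ∷ X))
               (assign2 (embed ones) (blockReason b (x ∷ X))) (assign2 (embed ones) (blockReason b (x ∷ x ∷ X)))
duplicateHead-Matches b x X = record
  { folding = duplicateHead
  ; folds   = λ { zero → refl ; (suc j) → refl }
  ; twins   = count-mono (λ j → lookup XB j Bool.≟ x) (Game.twin? (x ∷ X) XB ρB (suc zero))
                λ {j} XBⱼ≡x → trans (profile-blockReason b XB j) (cong (λ y → y , v1 ∷ pin b y ∷ []) XBⱼ≡x)
  }
  where
  XB : Vec Bool _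
  XB = x ∷ x ∷ X
  ρB : Assignment _ 2
  ρB = assign2 (embed ones) (blockReason b XB)

theorem1 : Σ (Formula 2) (λ φ → (n : ℕ) (T : DTree n) → ValidDTree T →
             (e : Inst n) (e' : PInst n) →
             Sat (classify T) φ (assign2 (embed e) e') ⇔ MinimumSR T e e') → ⊥
theorem1 (φ , defines) = blockReason-not-minimum true XB unbalanced (Equivalence.to (defines-minimum XB) satB)
  where
  K : ℕ
  K = threshold φ
  XA : Vec Bool (suc K * 2)
  XA = balanced (suc K)
  XB : Vec Bool (suc (suc K * 2))
  XB = true ∷ XA
  defines-minimum : (X : Vec Bool n) →
    Sat (classify (dnfTree X)) φ (assign2 (embed ones) (blockReason true X)) ⇔
    MinimumSR (dnfTree X) ones (blockReason true X)
  defines-minimum X = defines _ (dnfTree X) (dnfTree-valid X) ones (blockReason true X)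
  satA : Sat (classify (dnfTree XA)) φ (assign2 (embed ones) (blockReason true XA))
  satA = Equivalence.from (defines-minimum XA) (blockReason-minimum true XA
           (≤-reflexive (trans (occurrences-balanced true (suc K)) (sym (occurrences-balanced false (suc K))))))
  enough-twins : K ≤ occurrences true (true ∷ XA)
  enough-twins = subst (K ≤_) (sym (cong (2 +_) (occurrences-balanced true K))) (m≤n+m K 2)
  satB : Sat (classify (dnfTree XB)) φ (assign2 (embed ones) (blockReason true XB))
  satB = Equivalence.to (Game.transfer XA XB φ enough-twins (duplicateHead-Matches true true (false ∷ balanced K)))
           satA
  unbalanced : occurrences false XB < occurrences true XB
  unbalanced = subst₂ _<_ (sym (occurrences-balanced false (suc K)))
                          (sym (cong suc (occurrences-balanced true (suc K)))) ≤-refl
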